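{- Define $a:\mathbb{Z}_{\geq 0}\to\mathbb{Z}$ by $a(0)=1$ and $a(n)=2(-1)^n$ for $n>0$. Define $b:\mathbb{Z}_{\geq0}\to\mathbb{Z}$ by $b(0)=1$, $b(3m)=2(-1)^m$ for integers $m>0$, and $b(n)=(-1)^{n-1}$ if $n$ is not divisible by $3$. For $n\geq 0$ set \[ a'_6(n)=\sum_{\substack{x,y\geq 0\\ x^2+y^2=n}} a(x)\,b(y), \] the sum over pairs of non-negative integers $(x,y)$, and let $r(n)$ be the number of pairs $(x,y)\in\mathbb{Z}^2$ with $x^2+y^2=n$. Then for all integers $m\geq 0$, \[ a'_6(3m)=(-1)^m\, r(3m),\qquad a'_6(3m+1)=(-1)^{m+1}\,\frac{r(3m+1)}{4},\qquad a'_6(3m+2)=(-1)^{m+1}\,\frac{r(3m+2)}{2}. \] -}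

module Defs where

open import Data.Nat as ℕ using (ℕ; zero; suc)
open import Data.Nat.DivMod using (_%_; _/_)
open import Data.Integer as ℤ using (ℤ; +_; -_)
open import Data.List using (List; []; _∷_; map; concatMap; upTo; filter; length; foldr)
open import Data.Bool using (if_then_else_)
open import Relation.Nullary.Decidable using (⌊_⌋)

sgn : ℕ → ℤ
sgn zero = + 1
sgn (suc n) = - sgn n

a : ℕ → ℤ
a zero = + 1
a n@(suc _) = + 2 ℤ.* sgn n

b : ℕ → ℤ
b zero = + 1
b n@(suc k) with n % 3
... | zero = + 2 ℤ.* sgn (n / 3)
... | suc _ = sgn k

-- a'_6(n) = Σ_{x,y ≥ 0, x²+y² = n} a(x) b(y)
-- (any such x, y satisfy x, y ≤ n, so summing over 0..n is exhaustive)
a'6 : ℕ → ℤ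
a'6 n = foldr ℤ._+_ (+ 0) (concatMap (λ x → map (λ y →
          if ⌊ x ℕ.* x ℕ.+ y ℕ.* y ℕ.≟ n ⌋ then a x ℤ.* b y else + 0)
        (upTo (suc n))) (upTo (suc n)))

range : ℕ → List ℤ
range n = map (λ k → + k) (upTo (suc n)) Data.List.++ map (λ k → - (+ suc k)) (upTo n)

-- r(n) = #{(x,y) ∈ ℤ² : x² + y² = n}
-- (any such x, y satisfy |x|, |y| ≤ n, so counting over [-n,n]² is exhaustive)
r : ℕ → ℕ
r n = length (filter (λ p → (ℤ._*_ (Data.Product.proj₁ p) (Data.Product.proj₁ p)
                              ℤ.+ ℤ._*_ (Data.Product.proj₂ p) (Data.Product.proj₂ p)) ℤ.≟ + n)
        (concatMap (λ x → map (λ y → x Data.Product., y) (range n)) (range n)))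
  where import Data.Product

{-# OPTIONS --safe #-}

-- Write a(x) = w(x) (-1)^x and 2 b(y) = χ(y) w(y) (-1)^y, where w(k) ∈ {1, 2} counts the
-- integers of absolute value k and χ(y) is 2 or -1 according as 3 divides y or not. Then
-- r(n) is the sum of w(x) w(y) over the non-negative solutions of x² + y² = n, and on that
-- circle (-1)^x (-1)^y = (-1)^n while, squares being 0 or 1 mod 3, χ(x) + χ(y) = 4 - 3 (n mod 3).
-- Symmetrising the sum defining a'_6 in x and y therefore gives
-- 4 a'_6(n) = (4 - 3 (n mod 3)) (-1)^n r(n), and the three cases follow.

module Submission where

open import Defs
open import Data.Nat using (ℕ; NonZero; zero; suc; _+_; _*_; _<_; _≟_; s≤s)
import Data.Nat.Properties as ℕₚ
open import Data.Nat.DivMod using (_%_; _/_; m≡m%n+[m/n]*n; m%n<n; m*n%n≡0; %-distribˡ-+; %-distribˡ-*; [m+kn]%n≡m%n)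
open import Data.Integer as ℤ using (ℤ; +_; -_; _-_) renaming (_+_ to _+ℤ_; _*_ to _*ℤ_)
import Data.Integer.Properties as ℤₚ
open import Data.Integer.Tactic.RingSolver using (solve-∀)
open import Data.List using (List; []; _∷_; _++_; map; concatMap; foldr; filter; length; upTo; applyUpTo)
import Data.List.Properties as Listₚ
open import Data.Bool using (Bool; true; false; if_then_else_)
open import Data.Product using (_×_; _,_)
open import Function using (_∘_)
open import Relation.Nullary using (Dec; does; yes; no)
open import Relation.Nullary.Decidable using (⌊_⌋; isYes≗does)
open import Relation.Binary.PropositionalEquality using (_≡_; refl; sym; trans; cong; cong₂; module ≡-Reasoning)

sum : List ℤ → ℤ
sum = foldr _+ℤ_ (+ 0)

∑ : {A : Set} → List A → (A → ℤ) → ℤ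
∑ xs f = sum (map f xs)

infix 5 ∑
syntax ∑ xs (λ x → e) = ∑[ x ∈ xs ] e

sum-++ : ∀ xs ys → sum (xs ++ ys) ≡ sum xs +ℤ sum ys
sum-++ []       ys = sym (ℤₚ.+-identityˡ (sum ys))
sum-++ (x ∷ xs) ys = trans (cong (x +ℤ_) (sum-++ xs ys)) (sym (ℤₚ.+-assoc x (sum xs) (sum ys)))

sum-concatMap : {A : Set} (g : A → List ℤ) (xs : List A) → sum (concatMap g xs) ≡ ∑[ x ∈ xs ] sum (g x)
sum-concatMap g []       = refl
sum-concatMap g (x ∷ xs) = trans (sum-++ (g x) (concatMap g xs)) (cong (sum (g x) +ℤ_) (sum-concatMap g xs))

module _ {A B : Set} where

  ∑-map : (g : A → B) (xs : List A) (f : B → ℤ) → ∑ (map g xs) f ≡ ∑[ x ∈ xs ] f (g x)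
  ∑-map g xs f = cong sum (sym (Listₚ.map-∘ xs))

  ∑-concatMap : (g : A → List B) (xs : List A) (f : B → ℤ) → ∑ (concatMap g xs) f ≡ ∑[ x ∈ xs ] ∑ (g x) f
  ∑-concatMap g xs f = trans (cong sum (Listₚ.map-concatMap f g xs)) (sum-concatMap (map f ∘ g) xs)

module _ {A : Set} where

  ∑-++ : (xs ys : List A) (f : A → ℤ) → ∑ (xs ++ ys) f ≡ ∑ xs f +ℤ ∑ ys f
  ∑-++ xs ys f = trans (cong sum (Listₚ.map-++ f xs ys)) (sum-++ (map f xs) (map f ys))

  ∑-cong : {f g : A → ℤ} → (∀ x → f x ≡ g x) → (xs : List A) → ∑ xs f ≡ ∑ xs g
  ∑-cong f≗g xs = cong sum (Listₚ.map-cong f≗g xs)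

  ∑-*ˡ : (c : ℤ) (xs : List A) (f : A → ℤ) → ∑[ x ∈ xs ] (c *ℤ f x) ≡ c *ℤ ∑ xs f
  ∑-*ˡ c []       f = sym (ℤₚ.*-zeroʳ c)
  ∑-*ˡ c (x ∷ xs) f = trans (cong (c *ℤ f x +ℤ_) (∑-*ˡ c xs f)) (sym (ℤₚ.*-distribˡ-+ c (f x) (∑ xs f)))

  ∑-+ : (xs : List A) (f g : A → ℤ) → ∑[ x ∈ xs ] (f x +ℤ g x) ≡ ∑ xs f +ℤ ∑ xs g
  ∑-+ []       f g = refl
  ∑-+ (x ∷ xs) f g = trans (cong (f x +ℤ g x +ℤ_) (∑-+ xs f g)) (interchange (f x) (g x) (∑ xs f) (∑ xs g))
    where
    interchange : ∀ p q s t → p +ℤ q +ℤ (s +ℤ t) ≡ p +ℤ s +ℤ (q +ℤ t)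
    interchange = solve-∀

  ∑-zero : (xs : List A) → ∑[ x ∈ xs ] + 0 ≡ + 0
  ∑-zero []       = refl
  ∑-zero (x ∷ xs) = trans (ℤₚ.+-identityˡ _) (∑-zero xs)

∑-swap : {A B : Set} (xs : List A) (ys : List B) (f : A → B → ℤ) →
         ∑[ x ∈ xs ] ∑[ y ∈ ys ] f x y ≡ ∑[ y ∈ ys ] ∑[ x ∈ xs ] f x y
∑-swap []       ys f = sym (∑-zero ys)
∑-swap (x ∷ xs) ys f =
  trans (cong (∑ ys (f x) +ℤ_) (∑-swap xs ys f)) (sym (∑-+ ys (f x) (λ y → ∑[ x ∈ xs ] f x y)))

∑-applyUpTo : (g : ℕ → ℕ) (n : ℕ) (f : ℕ → ℤ) → ∑ (applyUpTo g n) f ≡ ∑[ k ∈ upTo n ] f (g k)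
∑-applyUpTo g n f = cong sum (trans (Listₚ.map-applyUpTo g f n) (sym (Listₚ.map-applyUpTo (λ k → k) (f ∘ g) n)))

𝟙 : Bool → ℤ
𝟙 true  = + 1
𝟙 false = + 0

*-𝟙 : ∀ c d g → c *ℤ (d *ℤ 𝟙 g) ≡ (if g then c *ℤ d else + 0)
*-𝟙 c d true  = cong (c *ℤ_) (ℤₚ.*-identityʳ d)
*-𝟙 c d false = trans (cong (c *ℤ_) (ℤₚ.*-zeroʳ d)) (ℤₚ.*-zeroʳ c)

+length-filter : {A : Set} {P : A → Set} (P? : ∀ x → Dec (P x)) (xs : List A) →
                 + length (filter P? xs) ≡ ∑[ x ∈ xs ] 𝟙 (does (P? x))
+length-filter P? []       = refl
+length-filter P? (x ∷ xs) with does (P? x)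
... | false = trans (+length-filter P? xs) (sym (ℤₚ.+-identityˡ _))
... | true  = cong (+ 1 +ℤ_) (+length-filter P? xs)

-- the number of integers X with ∣ X ∣ ≡ k
mult : ℕ → ℤ
mult zero    = + 1
mult (suc _) = + 2

∑-range-even : (n : ℕ) (h : ℤ → ℤ) → (∀ X → h (- X) ≡ h X) →
          ∑[ X ∈ range n ] h X ≡ ∑[ k ∈ upTo (suc n) ] mult k *ℤ h (+ k)
∑-range-even n h h-even = begin
    ∑[ X ∈ range n ] h X
  ≡⟨ ∑-++ (map +_ (upTo (suc n))) (map (λ k → - (+ suc k)) (upTo n)) h ⟩
    ∑ (map +_ (upTo (suc n))) h +ℤ ∑ (map (λ k → - (+ suc k)) (upTo n)) h
  ≡⟨ cong₂ _+ℤ_ (∑-map +_ (upTo (suc n)) h) (∑-map (λ k → - (+ suc k)) (upTo n) h) ⟩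
    h (+ 0) +ℤ ∑ (applyUpTo suc n) (h ∘ +_) +ℤ (∑[ k ∈ upTo n ] h (- (+ suc k)))
  ≡⟨ cong₂ (λ s t → h (+ 0) +ℤ s +ℤ t) (∑-applyUpTo suc n (h ∘ +_))
                                         (∑-cong (λ k → h-even (+ suc k)) (upTo n)) ⟩
    h (+ 0) +ℤ S +ℤ S
  ≡⟨ double (h (+ 0)) S ⟩
    + 1 *ℤ h (+ 0) +ℤ + 2 *ℤ S
  ≡⟨ cong (+ 1 *ℤ h (+ 0) +ℤ_) (sym (trans (∑-applyUpTo suc n (λ k → mult k *ℤ h (+ k)))
                                             (∑-*ˡ (+ 2) (upTo n) (λ k → h (+ suc k))))) ⟩
    ∑[ k ∈ upTo (suc n) ] mult k *ℤ h (+ k)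
  ∎
  where
  open ≡-Reasoning
  S : ℤ
  S = ∑[ k ∈ upTo n ] h (+ suc k)
  double : ∀ x s → x +ℤ s +ℤ s ≡ + 1 *ℤ x +ℤ + 2 *ℤ s
  double = solve-∀

onCircle : ℕ → (ℕ → ℕ → ℤ) → ℕ → ℕ → ℤ
onCircle n f x y = if ⌊ x * x + y * y ≟ n ⌋ then f x y else + 0

circleSum : ℕ → (ℕ → ℕ → ℤ) → ℤ
circleSum n f = ∑[ x ∈ upTo (suc n) ] ∑[ y ∈ upTo (suc n) ] onCircle n f x y

module _ (n : ℕ) where

  onCircle-cong : {f g : ℕ → ℕ → ℤ} → (∀ x y → x * x + y * y ≡ n → f x y ≡ g x y) →
                  ∀ x y → onCircle n f x y ≡ onCircle n g x y
  onCircle-cong f≗g x y with x * x + y * y ≟ n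
  ... | yes on = f≗g x y on
  ... | no _   = refl

  onCircle-*ˡ : (c : ℤ) (f : ℕ → ℕ → ℤ) →
                ∀ x y → c *ℤ onCircle n f x y ≡ onCircle n (λ x y → c *ℤ f x y) x y
  onCircle-*ˡ c f x y with x * x + y * y ≟ n
  ... | yes _ = refl
  ... | no _  = ℤₚ.*-zeroʳ c

  onCircle-+ : (f g : ℕ → ℕ → ℤ) →
               ∀ x y → onCircle n (λ x y → f x y +ℤ g x y) x y ≡ onCircle n f x y +ℤ onCircle n g x y
  onCircle-+ f g x y with x * x + y * y ≟ n
  ... | yes _ = refl
  ... | no _  = refl

  onCircle-transpose : (f : ℕ → ℕ → ℤ) → ∀ x y → onCircle n f y x ≡ onCircle n (λ x y → f y x) x y
  onCircle-transpose f x y rewrite ℕₚ.+-comm (y * y) (x * x) = refl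

  circleSum-cong : {f g : ℕ → ℕ → ℤ} → (∀ x y → x * x + y * y ≡ n → f x y ≡ g x y) →
                   circleSum n f ≡ circleSum n g
  circleSum-cong {f} {g} f≗g = ∑-cong (λ x → ∑-cong (onCircle-cong {f} {g} f≗g x) (upTo (suc n))) (upTo (suc n))

  circleSum-*ˡ : (c : ℤ) (f : ℕ → ℕ → ℤ) → c *ℤ circleSum n f ≡ circleSum n (λ x y → c *ℤ f x y)
  circleSum-*ˡ c f = begin
      c *ℤ circleSum n f
    ≡⟨ sym (∑-*ˡ c (upTo (suc n)) (λ x → ∑ (upTo (suc n)) (onCircle n f x))) ⟩
      ∑[ x ∈ upTo (suc n) ] c *ℤ (∑[ y ∈ upTo (suc n) ] onCircle n f x y)
    ≡⟨ ∑-cong (λ x → sym (∑-*ˡ c (upTo (suc n)) (onCircle n f x))) (upTo (suc n)) ⟩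
      ∑[ x ∈ upTo (suc n) ] ∑[ y ∈ upTo (suc n) ] c *ℤ onCircle n f x y
    ≡⟨ ∑-cong (λ x → ∑-cong (onCircle-*ˡ c f x) (upTo (suc n))) (upTo (suc n)) ⟩
      circleSum n (λ x y → c *ℤ f x y)
    ∎
    where open ≡-Reasoning

  circleSum-+ : (f g : ℕ → ℕ → ℤ) → circleSum n (λ x y → f x y +ℤ g x y) ≡ circleSum n f +ℤ circleSum n g
  circleSum-+ f g = begin
      circleSum n (λ x y → f x y +ℤ g x y)
    ≡⟨ ∑-cong (λ x → ∑-cong (onCircle-+ f g x) (upTo (suc n))) (upTo (suc n)) ⟩
      ∑[ x ∈ upTo (suc n) ] ∑[ y ∈ upTo (suc n) ] (onCircle n f x y +ℤ onCircle n g x y)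
    ≡⟨ ∑-cong (λ x → ∑-+ (upTo (suc n)) (onCircle n f x) (onCircle n g x)) (upTo (suc n)) ⟩
      ∑[ x ∈ upTo (suc n) ] ((∑[ y ∈ upTo (suc n) ] onCircle n f x y) +ℤ (∑[ y ∈ upTo (suc n) ] onCircle n g x y))
    ≡⟨ ∑-+ (upTo (suc n)) (λ x → ∑ (upTo (suc n)) (onCircle n f x))
                          (λ x → ∑ (upTo (suc n)) (onCircle n g x)) ⟩
      circleSum n f +ℤ circleSum n g
    ∎
    where open ≡-Reasoning

  circleSum-transpose : (f : ℕ → ℕ → ℤ) → circleSum n (λ x y → f y x) ≡ circleSum n f
  circleSum-transpose f = begin
      circleSum n (λ x y → f y x)
    ≡⟨ ∑-cong (λ x → ∑-cong (λ y → sym (onCircle-transpose f x y)) (upTo (suc n))) (upTo (suc n)) ⟩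
      ∑[ x ∈ upTo (suc n) ] ∑[ y ∈ upTo (suc n) ] onCircle n f y x
    ≡⟨ ∑-swap (upTo (suc n)) (upTo (suc n)) (λ x y → onCircle n f y x) ⟩
      circleSum n f
    ∎
    where open ≡-Reasoning

a'6≡circleSum : ∀ n → a'6 n ≡ circleSum n (λ x y → a x *ℤ b y)
a'6≡circleSum n = sum-concatMap (λ x → map (onCircle n (λ x y → a x *ℤ b y) x) (upTo (suc n))) (upTo (suc n))

r≡circleSum : ∀ n → + r n ≡ circleSum n (λ x y → mult x *ℤ mult y)
r≡circleSum n = begin
    + r n
  ≡⟨ +length-filter P? pairs ⟩
    ∑[ p ∈ pairs ] 𝟙 (does (P? p))
  ≡⟨ ∑-concatMap (λ X → map (X ,_) (range n)) (range n) (λ p → 𝟙 (does (P? p))) ⟩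
    ∑[ X ∈ range n ] ∑ (map (X ,_) (range n)) (λ p → 𝟙 (does (P? p)))
  ≡⟨ ∑-cong (λ X → ∑-map (X ,_) (range n) (λ p → 𝟙 (does (P? p)))) (range n) ⟩
    ∑[ X ∈ range n ] ∑[ Y ∈ range n ] q X Y
  ≡⟨ ∑-cong (λ X → ∑-range-even n (q X) (q-evenʳ X)) (range n) ⟩
    ∑[ X ∈ range n ] ∑[ k ∈ upTo (suc n) ] mult k *ℤ q X (+ k)
  ≡⟨ ∑-range-even n (λ X → ∑[ k ∈ upTo (suc n) ] mult k *ℤ q X (+ k))
       (λ X → ∑-cong (λ k → cong (mult k *ℤ_) (q-evenˡ X (+ k))) (upTo (suc n))) ⟩
    ∑[ j ∈ upTo (suc n) ] mult j *ℤ (∑[ k ∈ upTo (suc n) ] mult k *ℤ q (+ j) (+ k))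
  ≡⟨ ∑-cong (λ j → trans (sym (∑-*ˡ (mult j) (upTo (suc n)) (λ k → mult k *ℤ q (+ j) (+ k))))
                         (∑-cong (count-on-circle j) (upTo (suc n)))) (upTo (suc n)) ⟩
    circleSum n (λ x y → mult x *ℤ mult y)
  ∎
  where
  open ≡-Reasoning
  P? : (p : ℤ × ℤ) → Dec _
  P? (X , Y) = X *ℤ X +ℤ Y *ℤ Y ℤ.≟ + n
  pairs : List (ℤ × ℤ)
  pairs = concatMap (λ X → map (X ,_) (range n)) (range n)
  q : ℤ → ℤ → ℤ
  q X Y = 𝟙 (does (P? (X , Y)))
  neg-square : ∀ X → - X *ℤ - X ≡ X *ℤ X
  neg-square = solve-∀
  q-evenˡ : ∀ X Y → q (- X) Y ≡ q X Y
  q-evenˡ X Y = cong (λ Z → 𝟙 (does (Z +ℤ Y *ℤ Y ℤ.≟ + n))) (neg-square X)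
  q-evenʳ : ∀ X Y → q X (- Y) ≡ q X Y
  q-evenʳ X Y = cong (λ Z → 𝟙 (does (X *ℤ X +ℤ Z ℤ.≟ + n))) (neg-square Y)
  pos-sum-of-squares : ∀ j k → + j *ℤ + j +ℤ + k *ℤ + k ≡ + (j * j + k * k)
  pos-sum-of-squares j k = sym (trans (ℤₚ.pos-+ (j * j) (k * k)) (cong₂ _+ℤ_ (ℤₚ.pos-* j j) (ℤₚ.pos-* k k)))
  count-on-circle : ∀ j k → mult j *ℤ (mult k *ℤ q (+ j) (+ k)) ≡ onCircle n (λ x y → mult x *ℤ mult y) j k
  count-on-circle j k rewrite pos-sum-of-squares j k =
    trans (*-𝟙 (mult j) (mult k) (does (j * j + k * k ≟ n)))
          (cong (λ g → if g then mult j *ℤ mult k else + 0) (sym (isYes≗does (j * j + k * k ≟ n))))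

neg-square : ∀ X → - X *ℤ - X ≡ X *ℤ X
neg-square = solve-∀

sgn-+ : ∀ m n → sgn (m + n) ≡ sgn m *ℤ sgn n
sgn-+ zero    n = sym (ℤₚ.*-identityˡ (sgn n))
sgn-+ (suc m) n = trans (cong -_ (sgn-+ m n)) (ℤₚ.neg-distribˡ-* (sgn m) (sgn n))

sgn-*-sgn : ∀ n → sgn n *ℤ sgn n ≡ + 1
sgn-*-sgn zero    = refl
sgn-*-sgn (suc n) = trans (neg-square (sgn n)) (sgn-*-sgn n)

sgn-double : ∀ n → sgn (n + n) ≡ + 1
sgn-double n = trans (sgn-+ n n) (sgn-*-sgn n)

sgn-3* : ∀ m → sgn (3 * m) ≡ sgn m
sgn-3* m = begin
    sgn (m + 2 * m)
  ≡⟨ sgn-+ m (2 * m) ⟩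
    sgn m *ℤ sgn (2 * m)
  ≡⟨ cong (λ k → sgn m *ℤ sgn (m + k)) (ℕₚ.+-identityʳ m) ⟩
    sgn m *ℤ sgn (m + m)
  ≡⟨ cong (sgn m *ℤ_) (sgn-double m) ⟩
    sgn m *ℤ + 1
  ≡⟨ ℤₚ.*-identityʳ (sgn m) ⟩
    sgn m
  ∎
  where open ≡-Reasoning

sgn-3*-+ : ∀ m k → sgn (3 * m + k) ≡ sgn (m + k)
sgn-3*-+ m k = trans (sgn-+ (3 * m) k) (trans (cong (_*ℤ sgn k) (sgn-3* m)) (sym (sgn-+ m k)))

sgn-square : ∀ n → sgn (n * n) ≡ sgn n
sgn-square zero    = refl
sgn-square (suc n) = cong -_ (begin
    sgn (n + n * suc n)
  ≡⟨ cong (λ k → sgn (n + k)) (ℕₚ.*-suc n n) ⟩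
    sgn (n + (n + n * n))
  ≡⟨ cong sgn (sym (ℕₚ.+-assoc n n (n * n))) ⟩
    sgn (n + n + n * n)
  ≡⟨ sgn-+ (n + n) (n * n) ⟩
    sgn (n + n) *ℤ sgn (n * n)
  ≡⟨ cong₂ _*ℤ_ (sgn-double n) (sgn-square n) ⟩
    + 1 *ℤ sgn n
  ≡⟨ ℤₚ.*-identityˡ (sgn n) ⟩
    sgn n
  ∎)
  where open ≡-Reasoning

sgn-sum-of-squares : ∀ x y {n} → x * x + y * y ≡ n → sgn x *ℤ sgn y ≡ sgn n
sgn-sum-of-squares x y {n} on = begin
    sgn x *ℤ sgn y
  ≡⟨ sym (cong₂ _*ℤ_ (sgn-square x) (sgn-square y)) ⟩
    sgn (x * x) *ℤ sgn (y * y)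
  ≡⟨ sym (sgn-+ (x * x) (y * y)) ⟩
    sgn (x * x + y * y)
  ≡⟨ cong sgn on ⟩
    sgn n
  ∎
  where open ≡-Reasoning

χ₃ : ℕ → ℤ
χ₃ zero    = + 2
χ₃ (suc _) = - + 1

ρ₃ : ℕ → ℤ
ρ₃ k = + 4 - + 3 *ℤ + k

χ₃-residues : ∀ s t → s < 3 → t < 3 → χ₃ s +ℤ χ₃ t ≡ ρ₃ ((s * s + t * t) % 3)
χ₃-residues 0 0 _ _ = refl
χ₃-residues 0 1 _ _ = refl
χ₃-residues 0 2 _ _ = refl
χ₃-residues 1 0 _ _ = refl
χ₃-residues 1 1 _ _ = refl
χ₃-residues 1 2 _ _ = refl
χ₃-residues 2 0 _ _ = refl
χ₃-residues 2 1 _ _ = refl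
χ₃-residues 2 2 _ _ = refl
χ₃-residues (suc (suc (suc _))) _ (s≤s (s≤s (s≤s ()))) _
χ₃-residues _ (suc (suc (suc _))) _ (s≤s (s≤s (s≤s ())))

sum-of-squares-% : ∀ x y d .{{_ : NonZero d}} → (x * x + y * y) % d ≡ ((x % d) * (x % d) + (y % d) * (y % d)) % d
sum-of-squares-% x y d = begin
    (x * x + y * y) % d
  ≡⟨ %-distribˡ-+ (x * x) (y * y) d ⟩
    ((x * x) % d + (y * y) % d) % d
  ≡⟨ cong₂ (λ u v → (u + v) % d) (%-distribˡ-* x x d) (%-distribˡ-* y y d) ⟩
    ((x % d) * (x % d) % d + (y % d) * (y % d) % d) % d
  ≡⟨ sym (%-distribˡ-+ ((x % d) * (x % d)) ((y % d) * (y % d)) d) ⟩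
    ((x % d) * (x % d) + (y % d) * (y % d)) % d
  ∎
  where open ≡-Reasoning

χ₃-sum-of-squares : ∀ x y {n} → x * x + y * y ≡ n → χ₃ (x % 3) +ℤ χ₃ (y % 3) ≡ ρ₃ (n % 3)
χ₃-sum-of-squares x y on =
  trans (χ₃-residues (x % 3) (y % 3) (m%n<n x 3) (m%n<n y 3))
        (cong ρ₃ (trans (sym (sum-of-squares-% x y 3)) (cong (_% 3) on)))

a≡mult*sgn : ∀ x → a x ≡ mult x *ℤ sgn x
a≡mult*sgn zero    = refl
a≡mult*sgn (suc x) = refl

sgn-/3 : ∀ y → y % 3 ≡ 0 → sgn (y / 3) ≡ sgn y
sgn-/3 y 3∣y = begin
    sgn (y / 3)
  ≡⟨ sym (sgn-3* (y / 3)) ⟩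
    sgn (3 * (y / 3))
  ≡⟨ cong sgn (ℕₚ.*-comm 3 (y / 3)) ⟩
    sgn (y / 3 * 3)
  ≡⟨ cong (λ k → sgn (k + y / 3 * 3)) (sym 3∣y) ⟩
    sgn (y % 3 + y / 3 * 3)
  ≡⟨ cong sgn (sym (m≡m%n+[m/n]*n y 3)) ⟩
    sgn y
  ∎
  where open ≡-Reasoning

2*b≡χ₃*mult*sgn : ∀ y → + 2 *ℤ b y ≡ χ₃ (y % 3) *ℤ (mult y *ℤ sgn y)
2*b≡χ₃*mult*sgn zero = refl
2*b≡χ₃*mult*sgn (suc k) with suc k % 3 in eq
... | zero  = cong (λ s → + 2 *ℤ (+ 2 *ℤ s)) (sgn-/3 (suc k) eq)
... | suc _ = flip-sign (sgn k)
  where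
  flip-sign : ∀ s → + 2 *ℤ s ≡ - + 1 *ℤ (+ 2 *ℤ - s)
  flip-sign = solve-∀

symmetrised-summand : ∀ {n} x y → x * x + y * y ≡ n →
                      + 2 *ℤ (a x *ℤ b y +ℤ a y *ℤ b x) ≡ ρ₃ (n % 3) *ℤ sgn n *ℤ (mult x *ℤ mult y)
symmetrised-summand {n} x y on = begin
    + 2 *ℤ (a x *ℤ b y +ℤ a y *ℤ b x)
  ≡⟨ distribute (a x) (a y) (b x) (b y) ⟩
    a x *ℤ (+ 2 *ℤ b y) +ℤ a y *ℤ (+ 2 *ℤ b x)
  ≡⟨ cong₂ _+ℤ_ (cong₂ _*ℤ_ (a≡mult*sgn x) (2*b≡χ₃*mult*sgn y))
                (cong₂ _*ℤ_ (a≡mult*sgn y) (2*b≡χ₃*mult*sgn x)) ⟩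
    mult x *ℤ sgn x *ℤ (χ₃ (y % 3) *ℤ (mult y *ℤ sgn y))
      +ℤ mult y *ℤ sgn y *ℤ (χ₃ (x % 3) *ℤ (mult x *ℤ sgn x))
  ≡⟨ collect (mult x) (mult y) (sgn x) (sgn y) (χ₃ (x % 3)) (χ₃ (y % 3)) ⟩
    (χ₃ (x % 3) +ℤ χ₃ (y % 3)) *ℤ (sgn x *ℤ sgn y) *ℤ (mult x *ℤ mult y)
  ≡⟨ cong₂ (λ c s → c *ℤ s *ℤ (mult x *ℤ mult y)) (χ₃-sum-of-squares x y on) (sgn-sum-of-squares x y on) ⟩
    ρ₃ (n % 3) *ℤ sgn n *ℤ (mult x *ℤ mult y)
  ∎
  where
  open ≡-Reasoning
  distribute : ∀ p p′ q q′ → + 2 *ℤ (p *ℤ q′ +ℤ p′ *ℤ q) ≡ p *ℤ (+ 2 *ℤ q′) +ℤ p′ *ℤ (+ 2 *ℤ q)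
  distribute = solve-∀
  collect : ∀ m m′ s s′ c c′ →
            m *ℤ s *ℤ (c′ *ℤ (m′ *ℤ s′)) +ℤ m′ *ℤ s′ *ℤ (c *ℤ (m *ℤ s))
              ≡ (c +ℤ c′) *ℤ (s *ℤ s′) *ℤ (m *ℤ m′)
  collect = solve-∀

four-a'6 : ∀ n → + 4 *ℤ a'6 n ≡ ρ₃ (n % 3) *ℤ sgn n *ℤ + r n
four-a'6 n = begin
    + 4 *ℤ a'6 n
  ≡⟨ cong (+ 4 *ℤ_) (a'6≡circleSum n) ⟩
    + 4 *ℤ A
  ≡⟨ four≡2*double A ⟩
    + 2 *ℤ (A +ℤ A)
  ≡⟨ cong (λ B → + 2 *ℤ (A +ℤ B)) (sym (circleSum-transpose n F)) ⟩
    + 2 *ℤ (A +ℤ circleSum n (λ x y → F y x))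
  ≡⟨ cong (+ 2 *ℤ_) (sym (circleSum-+ n F (λ x y → F y x))) ⟩
    + 2 *ℤ circleSum n (λ x y → F x y +ℤ F y x)
  ≡⟨ circleSum-*ˡ n (+ 2) (λ x y → F x y +ℤ F y x) ⟩
    circleSum n (λ x y → + 2 *ℤ (F x y +ℤ F y x))
  ≡⟨ circleSum-cong n symmetrised-summand ⟩
    circleSum n (λ x y → c *ℤ (mult x *ℤ mult y))
  ≡⟨ sym (circleSum-*ˡ n c (λ x y → mult x *ℤ mult y)) ⟩
    c *ℤ circleSum n (λ x y → mult x *ℤ mult y)
  ≡⟨ cong (c *ℤ_) (sym (r≡circleSum n)) ⟩
    c *ℤ + r n
  ∎
  where
  open ≡-Reasoning
  F : ℕ → ℕ → ℤ
  F x y = a x *ℤ b y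
  A : ℤ
  A = circleSum n F
  c : ℤ
  c = ρ₃ (n % 3) *ℤ sgn n
  four≡2*double : ∀ z → + 4 *ℤ z ≡ + 2 *ℤ (z +ℤ z)
  four≡2*double = solve-∀

[3m+k]%3≡k%3 : ∀ m k → (3 * m + k) % 3 ≡ k % 3
[3m+k]%3≡k%3 m k =
  trans (cong (_% 3) (trans (ℕₚ.+-comm (3 * m) k) (cong (λ j → k + j) (ℕₚ.*-comm 3 m)))) ([m+kn]%n≡m%n k m 3)

a'6-3* : ∀ m → a'6 (3 * m) ≡ sgn m *ℤ + r (3 * m)
a'6-3* m = ℤₚ.*-cancelˡ-≡ (+ 4) _ _ (begin
    + 4 *ℤ a'6 (3 * m)
  ≡⟨ four-a'6 (3 * m) ⟩
    ρ₃ ((3 * m) % 3) *ℤ sgn (3 * m) *ℤ + r (3 * m)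
  ≡⟨ cong₂ (λ k s → ρ₃ k *ℤ s *ℤ + r (3 * m))
           (trans (cong (_% 3) (ℕₚ.*-comm 3 m)) (m*n%n≡0 m 3)) (sgn-3* m) ⟩
    + 4 *ℤ sgn m *ℤ + r (3 * m)
  ≡⟨ ℤₚ.*-assoc (+ 4) (sgn m) (+ r (3 * m)) ⟩
    + 4 *ℤ (sgn m *ℤ + r (3 * m))
  ∎)
  where open ≡-Reasoning

a'6-3*+1 : ∀ m → + 4 *ℤ a'6 (3 * m + 1) ≡ sgn (m + 1) *ℤ + r (3 * m + 1)
a'6-3*+1 m = begin
    + 4 *ℤ a'6 (3 * m + 1)
  ≡⟨ four-a'6 (3 * m + 1) ⟩
    ρ₃ ((3 * m + 1) % 3) *ℤ sgn (3 * m + 1) *ℤ + r (3 * m + 1)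
  ≡⟨ cong₂ (λ k s → ρ₃ k *ℤ s *ℤ + r (3 * m + 1)) ([3m+k]%3≡k%3 m 1) (sgn-3*-+ m 1) ⟩
    + 1 *ℤ sgn (m + 1) *ℤ + r (3 * m + 1)
  ≡⟨ cong (_*ℤ + r (3 * m + 1)) (ℤₚ.*-identityˡ (sgn (m + 1))) ⟩
    sgn (m + 1) *ℤ + r (3 * m + 1)
  ∎
  where open ≡-Reasoning

a'6-3*+2 : ∀ m → + 2 *ℤ a'6 (3 * m + 2) ≡ sgn (m + 1) *ℤ + r (3 * m + 2)
a'6-3*+2 m = ℤₚ.*-cancelˡ-≡ (+ 2) _ _ (begin
    + 2 *ℤ (+ 2 *ℤ a'6 (3 * m + 2))
  ≡⟨ sym (ℤₚ.*-assoc (+ 2) (+ 2) (a'6 (3 * m + 2))) ⟩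
    + 4 *ℤ a'6 (3 * m + 2)
  ≡⟨ four-a'6 (3 * m + 2) ⟩
    ρ₃ ((3 * m + 2) % 3) *ℤ sgn (3 * m + 2) *ℤ + r (3 * m + 2)
  ≡⟨ cong₂ (λ k s → ρ₃ k *ℤ s *ℤ + r (3 * m + 2))
           ([3m+k]%3≡k%3 m 2) (trans (sgn-3*-+ m 2) (cong sgn (ℕₚ.+-suc m 1))) ⟩
    - + 2 *ℤ - sgn (m + 1) *ℤ + r (3 * m + 2)
  ≡⟨ neg-*-neg (sgn (m + 1)) (+ r (3 * m + 2)) ⟩
    + 2 *ℤ (sgn (m + 1) *ℤ + r (3 * m + 2))
  ∎)
  where
  open ≡-Reasoning
  neg-*-neg : ∀ s R → - + 2 *ℤ - s *ℤ R ≡ + 2 *ℤ (s *ℤ R)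
  neg-*-neg = solve-∀

lemma4p1 : (m : ℕ) →
    (a'6 (3 * m) ≡ sgn m *ℤ (+ r (3 * m)))
    × (+ 4 *ℤ a'6 (3 * m + 1) ≡ sgn (m + 1) *ℤ (+ r (3 * m + 1)))
    × (+ 2 *ℤ a'6 (3 * m + 2) ≡ sgn (m + 1) *ℤ (+ r (3 * m + 2)))
lemma4p1 m = a'6-3* m , a'6-3*+1 m , a'6-3*+2 m
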